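{- Let $k\ge 2$ be an integer, $p$ an odd prime, and $\mathcal{G}=\langle s,r : r^{2^kp}=s^2=e,\ srs^{ -1}=r^{2^{k-1}p-1}\rangle$, and put $u=r^{2^{k-1}p}$. Then the power graph $P(\mathcal{G})$ is the union (on the common vertex set $\mathcal{G}$, vertices with the same name being identified) of the following graphs: (i) the power graph $P(\langle r\rangle)\cong P(\mathbb{Z}_{2^kp})$ on the vertex set $\langle r\rangle$; (ii) $2^{k-1}p$ copies of $K_2$, namely the edges $\{e, sr^{2t}\}$ for $1\le t\le 2^{k-1}p$; (iii) $2^{k-2}p$ copies of the join $P(\langle u\rangle)+K_2$, one for each cyclic subgroup $\langle sr^{2j+1}\rangle$ ($0\le j\le 2^{k-1}p-1$) of order $4$, in which the two generators of $\langle sr^{2j+1}\rangle$ form the $K_2$ and are joined to both vertices $e,u$ of $P(\langle u\rangle)$. In the paper's notation: $P(\mathcal{G}) = P(\mathbb{Z}_{2^kp}) \cup 2^{k-1}p\,K_2 \cup 2^{k-2}p\left(P(\langle r^{2^{k-1}p}\rangle) + K_2\right)$.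
   Context: The power graph $P(\Omega)$ of a group $\Omega$ has vertex set $\Omega$, two distinct vertices being adjacent iff one is an integral power of the other. $K_n$ is the complete graph on $n$ vertices; $n\Gamma$ denotes $n$ copies of $\Gamma$; for graphs $\Gamma_1,\Gamma_2$, the join $\Gamma_1+\Gamma_2$ has vertex set $V(\Gamma_1)\cup V(\Gamma_2)$ and edges those of $\Gamma_1$, those of $\Gamma_2$, and all edges between a vertex of $\Gamma_1$ and a vertex of $\Gamma_2$. -}

module Defs where

open import Data.Nat using (ℕ; zero; suc; _+_; _*_; _∸_; _^_; _≤_; _<_; NonZero; _%_)
open import Data.Nat.Properties using (m*n≢0; m^n≢0)
open import Data.Nat.Primality using (Prime; prime⇒nonZero)
open import Data.Nat.DivMod using (_mod_)
open import Data.Fin using (Fin; toℕ)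
open import Data.Integer using (ℤ; +_; -[1+_])
open import Data.Product using (_×_; _,_; ∃; ∃-syntax)
open import Data.Sum using (_⊎_)
open import Relation.Binary.PropositionalEquality using (_≡_; _≢_)
open import Function.Bundles using (_⇔_)

module PowerGraph {A : Set} (_∙_ : A → A → A) (e : A) (inv : A → A) where

  _^ⁿ_ : A → ℕ → A
  x ^ⁿ zero  = e
  x ^ⁿ suc n = x ∙ (x ^ⁿ n)

  _^ᶻ_ : A → ℤ → A
  x ^ᶻ (+ n)      = x ^ⁿ n
  x ^ᶻ (-[1+ n ]) = inv x ^ⁿ suc n

  IsPowerOf : A → A → Set
  IsPowerOf y x = ∃[ z ] y ≡ x ^ᶻ z

  PAdj : A → A → Set
  PAdj x y = x ≢ y × (IsPowerOf y x ⊎ IsPowerOf x y)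

  Cyc : A → A → Set
  Cyc g x = IsPowerOf x g

  PAdjCyc : A → A → A → Set
  PAdjCyc g x y = Cyc g x × Cyc g y × PAdj x y

  Generates : A → A → Set
  Generates g h = ∀ x → (Cyc g x ⇔ Cyc h x)

  Complete : (A → Set) → A → A → Set
  Complete V x y = V x × V y × x ≢ y

  Join : (A → Set) → (A → A → Set) → (A → Set) → (A → A → Set) → A → A → Set
  Join V₁ E₁ V₂ E₂ x y = E₁ x y ⊎ E₂ x y ⊎ (V₁ x × V₂ y) ⊎ (V₂ x × V₁ y)

-- Concrete model of ⟨ s, r : r^N = s^2 = e, s r s⁻¹ = r^m ⟩ (valid when
-- m² ≡ 1 mod N): the element (a , i) stands for s^a r^i.

module Metacyclic (N m : ℕ) .{{_ : NonZero N}} where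

  G : Set
  G = Fin 2 × Fin N

  _∙_ : G → G → G
  (a , i) ∙ (b , j) = ((toℕ a + toℕ b) mod 2) , ((m ^ toℕ b * toℕ i + toℕ j) mod N)

  e : G
  e = (0 mod 2) , (0 mod N)

  inv : G → G
  inv (a , i) = a , ((N ∸ ((m ^ toℕ a * toℕ i) % N)) mod N)

  s : G
  s = (1 mod 2) , (0 mod N)

  r : G
  r = (0 mod 2) , (1 mod N)

  open PowerGraph _∙_ e inv public

N[_,_] : ℕ → ℕ → ℕ
N[ k , p ] = 2 ^ k * p

half[_,_] : ℕ → ℕ → ℕ
half[ k , p ] = 2 ^ (k ∸ 1) * p

nonZeroN : ∀ k p → Prime p → NonZero N[ k , p ]
nonZeroN k p pp = m*n≢0 (2 ^ k) p {{m^n≢0 2 k}} {{prime⇒nonZero pp}}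

module 𝒢 (k p : ℕ) (pp : Prime p) =
  Metacyclic N[ k , p ] (half[ k , p ] ∸ 1) {{nonZeroN k p pp}}

-- Write the elements as r^i and s r^i, and let H = 2^(k-1) p, which is even. Powers of rotations are
-- rotations, and s r^a squares to r^(H a), which is e for even a and u = r^H for odd a. So s r^a is an
-- involution for even a, while for odd a it generates {e, s r^a, u, s r^(a+H)}, whose two generators
-- s r^a and s r^(a+H) = (s r^a)⁻¹ have e and u as powers. Hence an edge of P(𝒢) lies in ⟨r⟩, joins e
-- to an involution, or lies in one of these cyclic subgroups of order 4.
module Submission where

open import Defs
open import Data.Nat using (ℕ; zero; suc; _+_; _*_; _∸_; _^_; _≤_; _<_; NonZero; _%_; s≤s; z≤n; ≢-nonZero⁻¹)
open import Data.Nat.Properties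
open import Data.Nat.DivMod using (_mod_; m%n%n≡m%n; %-distribˡ-+; %-distribˡ-*; [m+kn]%n≡m%n; m*n%n≡0; m<n⇒m%n≡m; m%n<n; %-remove-+ʳ)
open import Data.Nat.Divisibility using (_∣_; divides; ∣-refl)
open import Data.Nat.Primality using (Prime)
open import Data.Nat.Tactic.RingSolver using (solve-∀)
open import Data.Fin using (Fin; toℕ)
open import Data.Fin.Patterns using (0F; 1F)
open import Data.Fin.Properties using (toℕ-fromℕ<; toℕ-injective; toℕ<n)
open import Data.Integer using (+_; -[1+_])
open import Data.Product using (_×_; _,_; proj₁; proj₂; ∃-syntax)
open import Data.Sum using (_⊎_; inj₁; inj₂; [_,_]′; map₂)
open import Data.Empty using (⊥-elim)
open import Relation.Nullary using (¬_)
open import Relation.Binary.PropositionalEquality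
open import Function using (case_of_; _∘_; id)
open import Function.Bundles using (_⇔_; mk⇔; Equivalence)

even-or-odd : ∀ n → (∃[ c ] n ≡ 2 * c) ⊎ (∃[ c ] n ≡ 2 * c + 1)
even-or-odd zero = inj₁ (0 , refl)
even-or-odd (suc n) with even-or-odd n
... | inj₁ (c , refl) = inj₂ (c , +-comm 1 (2 * c))
... | inj₂ (c , refl) = inj₁ (suc c , 1+[2c+1]≡2[1+c] c)
  where
  1+[2c+1]≡2[1+c] : ∀ c → 1 + (2 * c + 1) ≡ 2 * (1 + c)
  1+[2c+1]≡2[1+c] = solve-∀

module PowerGraphProperties {A : Set} (_∙_ : A → A → A) (e : A) (inv : A → A)
                            (∙-identityʳ : ∀ x → x ∙ e ≡ x) where

  open PowerGraph _∙_ e inv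

  ^ⁿ-closed : ∀ (P : A → Set) {x} → P e → (∀ {y} → P y → P (x ∙ y)) → ∀ n → P (x ^ⁿ n)
  ^ⁿ-closed P Pe step zero    = Pe
  ^ⁿ-closed P Pe step (suc n) = step (^ⁿ-closed P Pe step n)

  Cyc-closed : ∀ (P : A → Set) {x} → P e → (∀ {y} → P y → P (x ∙ y)) →
               (∀ {y} → P y → P (inv x ∙ y)) → ∀ {y} → Cyc x y → P y
  Cyc-closed P Pe step step⁻¹ (+ n      , refl) = ^ⁿ-closed P Pe step n
  Cyc-closed P Pe step step⁻¹ (-[1+ n ] , refl) = ^ⁿ-closed P Pe step⁻¹ (suc n)

  Cyc-refl : ∀ {x} → Cyc x x
  Cyc-refl {x} = + 1 , sym (∙-identityʳ x)

  PAdj-sym : ∀ {x y} → PAdj x y → PAdj y x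
  PAdj-sym (x≢y , inj₁ y∈⟨x⟩) = (λ y≡x → x≢y (sym y≡x)) , inj₂ y∈⟨x⟩
  PAdj-sym (x≢y , inj₂ x∈⟨y⟩) = (λ y≡x → x≢y (sym y≡x)) , inj₁ x∈⟨y⟩

  identity-adjacent : ∀ {y} → e ≢ y → PAdj e y
  identity-adjacent e≢y = e≢y , inj₂ (+ 0 , refl)

  ≡⇒Generates : ∀ {g h} → g ≡ h → Generates g h
  ≡⇒Generates refl _ = mk⇔ (λ z∈⟨g⟩ → z∈⟨g⟩) (λ z∈⟨g⟩ → z∈⟨g⟩)

  Generates-inv : ∀ {x} → inv (inv x) ≡ x → Generates x (inv x)
  Generates-inv {x} inv²≡id z = mk⇔ to from
    where
    to : Cyc x z → Cyc (inv x) z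
    to (+ zero    , z≡e) = + 0 , z≡e
    to (+ suc n   , refl) = -[1+ n ] , cong (_^ⁿ suc n) (sym inv²≡id)
    to (-[1+ n ]  , refl) = + suc n , refl
    from : Cyc (inv x) z → Cyc x z
    from (+ zero    , z≡e) = + 0 , z≡e
    from (+ suc n   , refl) = -[1+ n ] , refl
    from (-[1+ n ]  , refl) = + suc n , cong (_^ⁿ suc n) inv²≡id

  generators-adjacent : ∀ {g x y} → Generates g x → Generates g y → x ≢ y → PAdj x y
  generators-adjacent {y = y} gen-x gen-y x≢y =
    x≢y , inj₁ (Equivalence.to (gen-x y) (Equivalence.from (gen-y y) Cyc-refl))

module ModularArithmetic (N : ℕ) .{{_ : NonZero N}} where

  infix 4 _≋_
  _≋_ : ℕ → ℕ → Set
  a ≋ b = a % N ≡ b % N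

  %-≋ : ∀ a → a % N ≋ a
  %-≋ a = m%n%n≡m%n a N

  +-cong-≋ : ∀ {a b c d} → a ≋ b → c ≋ d → a + c ≋ b + d
  +-cong-≋ {a} {b} {c} {d} a≋b c≋d = begin
    (a + c) % N          ≡⟨ %-distribˡ-+ a c N ⟩
    (a % N + c % N) % N  ≡⟨ cong₂ (λ x y → (x + y) % N) a≋b c≋d ⟩
    (b % N + d % N) % N  ≡⟨ %-distribˡ-+ b d N ⟨
    (b + d) % N          ∎
    where open ≡-Reasoning

  +-congˡ-≋ : ∀ c {a b} → a ≋ b → c + a ≋ c + b
  +-congˡ-≋ c = +-cong-≋ {c} {c} refl

  *-congˡ-≋ : ∀ c {a b} → a ≋ b → c * a ≋ c * b
  *-congˡ-≋ c {a} {b} a≋b = begin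
    (c * a) % N            ≡⟨ %-distribˡ-* c a N ⟩
    (c % N * (a % N)) % N  ≡⟨ cong (λ x → (c % N * x) % N) a≋b ⟩
    (c % N * (b % N)) % N  ≡⟨ %-distribˡ-* c b N ⟨
    (c * b) % N            ∎
    where open ≡-Reasoning

  +-*-≋ : ∀ a k → a + k * N ≋ a
  +-*-≋ a k = [m+kn]%n≡m%n a k N

  *-≋0 : ∀ k → k * N ≋ 0
  *-≋0 = +-*-≋ 0

  N≋0 : N ≋ 0
  N≋0 = %-remove-+ʳ 0 ∣-refl

  -- inv negates exponents as N ∸ c % N.
  ∸%-inverse : ∀ {x c} → x + c ≋ 0 → N ∸ c % N ≋ x
  ∸%-inverse {x} {c} x+c≋0 = begin
    d % N                  ≡⟨ cong (_% N) (+-identityʳ d) ⟨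
    (d + 0) % N            ≡⟨ +-congˡ-≋ d x+c≋0 ⟨
    (d + (x + c)) % N      ≡⟨ cong (_% N) (rearrange d x c) ⟩
    (x + (d + c)) % N      ≡⟨ +-congˡ-≋ x (+-congˡ-≋ d (%-≋ c)) ⟨
    (x + (d + c % N)) % N  ≡⟨ cong (λ y → (x + y) % N) (m∸n+n≡m (<⇒≤ (m%n<n c N))) ⟩
    (x + N) % N            ≡⟨ %-remove-+ʳ x ∣-refl ⟩
    x % N                  ∎
    where
    open ≡-Reasoning
    d : ℕ
    d = N ∸ c % N
    rearrange : ∀ d x c → d + (x + c) ≡ x + (d + c)
    rearrange = solve-∀

module MetacyclicProperties (N m : ℕ) .{{_ : NonZero N}} where

  open Metacyclic N m
  open ModularArithmetic N

  -- ρ i and σ i are r^i and s r^i, for an exponent i read modulo N.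
  ρ σ : ℕ → G
  ρ i = 0F , i mod N
  σ i = 1F , i mod N

  toℕ-mod-≋ : ∀ a → toℕ (a mod N) ≋ a
  toℕ-mod-≋ a = trans (cong (_% N) (toℕ-fromℕ< _)) (%-≋ a)

  affine-≋ : ∀ c a b → c * toℕ (a mod N) + toℕ (b mod N) ≋ c * a + b
  affine-≋ c a b = +-cong-≋ (*-congˡ-≋ c (toℕ-mod-≋ a)) (toℕ-mod-≋ b)

  mod-cong : ∀ {a b} → a ≋ b → a mod N ≡ b mod N
  mod-cong {a} {b} a≋b = toℕ-injective (begin
    toℕ (a mod N) ≡⟨ toℕ-fromℕ< _ ⟩
    a % N         ≡⟨ a≋b ⟩
    b % N         ≡⟨ toℕ-fromℕ< _ ⟨
    toℕ (b mod N) ∎)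
    where open ≡-Reasoning

  ρ-cong : ∀ {a b} → a ≋ b → ρ a ≡ ρ b
  ρ-cong a≋b = cong (0F ,_) (mod-cong a≋b)

  σ-cong : ∀ {a b} → a ≋ b → σ a ≡ σ b
  σ-cong a≋b = cong (1F ,_) (mod-cong a≋b)

  ρ-injective : ∀ {a b} → ρ a ≡ ρ b → a ≋ b
  ρ-injective {a} {b} ρa≡ρb = begin
    a % N         ≡⟨ toℕ-fromℕ< _ ⟨
    toℕ (a mod N) ≡⟨ cong (toℕ ∘ proj₂) ρa≡ρb ⟩
    toℕ (b mod N) ≡⟨ toℕ-fromℕ< _ ⟩
    b % N         ∎
    where open ≡-Reasoning

  mod-toℕ : ∀ (i : Fin N) → toℕ i mod N ≡ i
  mod-toℕ i = toℕ-injective (trans (toℕ-fromℕ< _) (m<n⇒m%n≡m (toℕ<n i)))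

  σ-toℕ : ∀ i → (1F , i) ≡ σ (toℕ i)
  σ-toℕ i = cong (1F ,_) (sym (mod-toℕ i))

  ρ∙ρ : ∀ a b → ρ a ∙ ρ b ≡ ρ (a + b)
  ρ∙ρ a b = ρ-cong (trans (affine-≋ 1 a b) (cong (λ x → (x + b) % N) (*-identityˡ a)))

  σ∙ρ : ∀ a b → σ a ∙ ρ b ≡ σ (a + b)
  σ∙ρ a b = σ-cong (trans (affine-≋ 1 a b) (cong (λ x → (x + b) % N) (*-identityˡ a)))

  σ∙σ : ∀ a b → σ a ∙ σ b ≡ ρ (m * a + b)
  σ∙σ a b = ρ-cong (trans (affine-≋ (m ^ 1) a b) (cong (λ x → (x * a + b) % N) (*-identityʳ m)))

  r^ⁿ≡ρ : ∀ n → r ^ⁿ n ≡ ρ n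
  r^ⁿ≡ρ zero    = refl
  r^ⁿ≡ρ (suc n) = trans (cong (r ∙_) (r^ⁿ≡ρ n)) (ρ∙ρ 1 n)

  s∙r^ⁿ≡σ : ∀ n → s ∙ (r ^ⁿ n) ≡ σ n
  s∙r^ⁿ≡σ n = trans (cong (s ∙_) (r^ⁿ≡ρ n)) (σ∙ρ 0 n)

  ∙-identityʳ : ∀ x → x ∙ e ≡ x
  ∙-identityʳ (0F , i) = begin
    (0F , i) ∙ ρ 0     ≡⟨ cong (λ j → (0F , j) ∙ ρ 0) (mod-toℕ i) ⟨
    ρ (toℕ i) ∙ ρ 0    ≡⟨ ρ∙ρ (toℕ i) 0 ⟩
    ρ (toℕ i + 0)      ≡⟨ cong ρ (+-identityʳ (toℕ i)) ⟩
    ρ (toℕ i)          ≡⟨ cong (0F ,_) (mod-toℕ i) ⟩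
    (0F , i)           ∎
    where open ≡-Reasoning
  ∙-identityʳ (1F , i) = begin
    (1F , i) ∙ ρ 0     ≡⟨ cong (λ j → (1F , j) ∙ ρ 0) (mod-toℕ i) ⟨
    σ (toℕ i) ∙ ρ 0    ≡⟨ σ∙ρ (toℕ i) 0 ⟩
    σ (toℕ i + 0)      ≡⟨ cong σ (+-identityʳ (toℕ i)) ⟩
    σ (toℕ i)          ≡⟨ cong (1F ,_) (mod-toℕ i) ⟩
    (1F , i)           ∎
    where open ≡-Reasoning

  inv-ρ : ∀ {a x} → x + a ≋ 0 → inv (ρ a) ≡ ρ x
  inv-ρ {a} {x} x+a≋0 = ρ-cong (∸%-inverse (trans (+-congˡ-≋ x 1*toℕ-a≋a) x+a≋0))
    where
    1*toℕ-a≋a : 1 * toℕ (a mod N) ≋ a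
    1*toℕ-a≋a = trans (cong (_% N) (*-identityˡ _)) (toℕ-mod-≋ a)

  inv-σ : ∀ {a x} → x + m * a ≋ 0 → inv (σ a) ≡ σ x
  inv-σ {a} {x} x+ma≋0 = σ-cong (∸%-inverse (trans (+-congˡ-≋ x m*toℕ-a≋m*a) x+ma≋0))
    where
    m*toℕ-a≋m*a : m ^ 1 * toℕ (a mod N) ≋ m * a
    m*toℕ-a≋m*a = trans (*-congˡ-≋ (m ^ 1) (toℕ-mod-≋ a)) (cong (λ y → (y * a) % N) (*-identityʳ m))

  open PowerGraphProperties _∙_ e inv ∙-identityʳ public

  Rotation : G → Set
  Rotation x = proj₁ x ≡ 0F

  σ-not-rotation : ∀ a → ¬ Rotation (σ a)
  σ-not-rotation a ()

  s∙r^ⁿ-not-rotation : ∀ n → ¬ Rotation (s ∙ (r ^ⁿ n))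
  s∙r^ⁿ-not-rotation n rot = σ-not-rotation n (subst Rotation (s∙r^ⁿ≡σ n) rot)

  rotation-∙ : ∀ {x y} → Rotation x → Rotation y → Rotation (x ∙ y)
  rotation-∙ {0F , _} {0F , _} refl refl = refl

  rotation-inv : ∀ {x} → Rotation x → Rotation (inv x)
  rotation-inv {0F , _} refl = refl

  Cyc-rotation : ∀ {x y} → Rotation x → Cyc x y → Rotation y
  Cyc-rotation {x} rot = Cyc-closed Rotation refl
    (λ {y} → rotation-∙ {x} {y} rot) (λ {y} → rotation-∙ {inv x} {y} (rotation-inv {x} rot))

  rotation∈⟨r⟩ : ∀ {x} → Rotation x → Cyc r x
  rotation∈⟨r⟩ {0F , i} refl = + toℕ i , sym (trans (r^ⁿ≡ρ (toℕ i)) (cong (0F ,_) (mod-toℕ i)))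

module Semidihedral (N H : ℕ) .{{_ : NonZero N}} (N≡2H : N ≡ 2 * H) (H-even : 2 ∣ H) where

  m : ℕ
  m = H ∸ 1

  open Metacyclic N m
  open MetacyclicProperties N m
  open ModularArithmetic N

  0<H : 0 < H
  0<H = n≢0⇒n>0 (λ H≡0 → ≢-nonZero⁻¹ N (trans N≡2H (cong (2 *_) H≡0)))

  H+H≡N : H + H ≡ N
  H+H≡N = trans (cong (λ n → H + n) (sym (+-identityʳ H))) (sym N≡2H)

  H<N : H < N
  H<N = subst (H <_) H+H≡N (m<m+n H 0<H)

  H+H≋0 : H + H ≋ 0
  H+H≋0 = trans (cong (_% N) H+H≡N) N≋0

  half-< : ∀ {c} → 2 * c < N → c < H
  half-< {c} 2c<N = *-cancelˡ-< 2 c H (subst (2 * c <_) N≡2H 2c<N)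

  half-odd-< : ∀ {c} → 2 * c + 1 < N → c < H
  half-odd-< {c} 2c+1<N = half-< (<-trans (m<m+n (2 * c) (s≤s z≤n)) 2c+1<N)

  m*a+a≡H*a : ∀ a → m * a + a ≡ H * a
  m*a+a≡H*a a = begin
    m * a + a      ≡⟨ cong (λ n → m * a + n) (*-identityˡ a) ⟨
    m * a + 1 * a  ≡⟨ *-distribʳ-+ a m 1 ⟨
    (m + 1) * a    ≡⟨ cong (_* a) (m∸n+n≡m 0<H) ⟩
    H * a          ∎
    where open ≡-Reasoning

  H*a+H*a≡a*N : ∀ a → H * a + H * a ≡ a * N
  H*a+H*a≡a*N a = trans (sym (*-distribʳ-+ a H H)) (trans (cong (_* a) H+H≡N) (*-comm N a))

  -- The one use of 2 ∣ H: H² ≡ 0 (mod 2H), equivalently m² ≡ 1 (mod N).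
  H*[H*a]≋0 : ∀ a → H * (H * a) ≋ 0
  H*[H*a]≋0 a = trans (cong (_% N) H*[H*a]≡q*a*N) (*-≋0 (q * a))
    where
    open _∣_ H-even renaming (quotient to q; equality to H≡q*2)
    regroup : ∀ q H a → q * 2 * (H * a) ≡ q * a * (H + H)
    regroup = solve-∀
    H*[H*a]≡q*a*N : H * (H * a) ≡ q * a * N
    H*[H*a]≡q*a*N = begin
      H * (H * a)         ≡⟨ cong (_* (H * a)) H≡q*2 ⟩
      q * 2 * (H * a)     ≡⟨ regroup q H a ⟩
      q * a * (H + H)     ≡⟨ cong (q * a *_) H+H≡N ⟩
      q * a * N           ∎
      where open ≡-Reasoning

  H*[2c]≡c*N : ∀ c → H * (2 * c) ≡ c * N
  H*[2c]≡c*N c = trans (regroup H c) (cong (c *_) H+H≡N)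
    where
    regroup : ∀ H c → H * (2 * c) ≡ c * (H + H)
    regroup = solve-∀

  H*[2c+1]≡H+c*N : ∀ c → H * (2 * c + 1) ≡ H + c * N
  H*[2c+1]≡H+c*N c = trans (regroup H c) (cong (λ n → H + c * n) H+H≡N)
    where
    regroup : ∀ H c → H * (2 * c + 1) ≡ H + c * (H + H)
    regroup = solve-∀

  m*a+[a+H*a]≡a*N : ∀ a → m * a + (a + H * a) ≡ a * N
  m*a+[a+H*a]≡a*N a = begin
    m * a + (a + H * a)  ≡⟨ +-assoc (m * a) a (H * a) ⟨
    m * a + a + H * a    ≡⟨ cong (_+ H * a) (m*a+a≡H*a a) ⟩
    H * a + H * a        ≡⟨ H*a+H*a≡a*N a ⟩
    a * N                ∎
    where open ≡-Reasoning

  m*[a+H*a]+a≡H*[H*a] : ∀ a → m * (a + H * a) + a ≡ H * (H * a)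
  m*[a+H*a]+a≡H*[H*a] a = begin
    m * (a + H * a) + a        ≡⟨ regroup m a (H * a) ⟩
    m * (H * a) + (m * a + a)  ≡⟨ cong (λ n → m * (H * a) + n) (m*a+a≡H*a a) ⟩
    m * (H * a) + H * a        ≡⟨ m*a+a≡H*a (H * a) ⟩
    H * (H * a)                ∎
    where
    open ≡-Reasoning
    regroup : ∀ m a b → m * (a + b) + a ≡ m * b + (m * a + a)
    regroup = solve-∀

  σ∙σ≡ρ[H*a] : ∀ a → σ a ∙ σ a ≡ ρ (H * a)
  σ∙σ≡ρ[H*a] a = trans (σ∙σ a a) (cong ρ (m*a+a≡H*a a))

  σ∙σ[a+H*a]≡e : ∀ a → σ a ∙ σ (a + H * a) ≡ e
  σ∙σ[a+H*a]≡e a = trans (σ∙σ a _) (ρ-cong (trans (cong (_% N) (m*a+[a+H*a]≡a*N a)) (*-≋0 a)))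

  σ[a+H*a]∙σ≡e : ∀ a → σ (a + H * a) ∙ σ a ≡ e
  σ[a+H*a]∙σ≡e a = trans (σ∙σ _ a) (ρ-cong (trans (cong (_% N) (m*[a+H*a]+a≡H*[H*a] a)) (H*[H*a]≋0 a)))

  σ[a+H*a]∙ρ[H*a]≡σ : ∀ a → σ (a + H * a) ∙ ρ (H * a) ≡ σ a
  σ[a+H*a]∙ρ[H*a]≡σ a = trans (σ∙ρ _ _) (σ-cong (begin
    (a + H * a + H * a) % N   ≡⟨ cong (_% N) (+-assoc a (H * a) (H * a)) ⟩
    (a + (H * a + H * a)) % N ≡⟨ cong (λ n → (a + n) % N) (H*a+H*a≡a*N a) ⟩
    (a + a * N) % N           ≡⟨ +-*-≋ a a ⟩
    a % N                     ∎))
    where open ≡-Reasoning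

  σ[a+H*a]∙σ[a+H*a]≡ρ[H*a] : ∀ a → σ (a + H * a) ∙ σ (a + H * a) ≡ ρ (H * a)
  σ[a+H*a]∙σ[a+H*a]≡ρ[H*a] a = trans (σ∙σ≡ρ[H*a] _) (ρ-cong (begin
    (H * (a + H * a)) % N       ≡⟨ cong (_% N) (*-distribˡ-+ H a (H * a)) ⟩
    (H * a + H * (H * a)) % N   ≡⟨ +-congˡ-≋ (H * a) (H*[H*a]≋0 a) ⟩
    (H * a + 0) % N             ≡⟨ cong (_% N) (+-identityʳ (H * a)) ⟩
    (H * a) % N                 ∎))
    where open ≡-Reasoning

  inv-σ≡σ[a+H*a] : ∀ a → inv (σ a) ≡ σ (a + H * a)
  inv-σ≡σ[a+H*a] a = inv-σ (trans (cong (_% N) (trans (+-comm _ (m * a)) (m*a+[a+H*a]≡a*N a))) (*-≋0 a))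

  inv-σ[a+H*a]≡σ : ∀ a → inv (σ (a + H * a)) ≡ σ a
  inv-σ[a+H*a]≡σ a = inv-σ (trans (cong (_% N) (trans (+-comm a _) (m*[a+H*a]+a≡H*[H*a] a))) (H*[H*a]≋0 a))

  inv-σ-involutive : ∀ a → inv (inv (σ a)) ≡ σ a
  inv-σ-involutive a = trans (cong inv (inv-σ≡σ[a+H*a] a)) (inv-σ[a+H*a]≡σ a)

  -- s r^a squares to the central element r^(H a), so ⟨s r^a⟩ consists of these four elements.
  Cycσ : ℕ → G → Set
  Cycσ a y = y ≡ e ⊎ y ≡ σ a ⊎ y ≡ ρ (H * a) ⊎ y ≡ σ (a + H * a)

  σ∙-Cycσ : ∀ a {y} → Cycσ a y → Cycσ a (σ a ∙ y)
  σ∙-Cycσ a (inj₁ refl)                 = inj₂ (inj₁ (∙-identityʳ (σ a)))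
  σ∙-Cycσ a (inj₂ (inj₁ refl))          = inj₂ (inj₂ (inj₁ (σ∙σ≡ρ[H*a] a)))
  σ∙-Cycσ a (inj₂ (inj₂ (inj₁ refl)))   = inj₂ (inj₂ (inj₂ (σ∙ρ a (H * a))))
  σ∙-Cycσ a (inj₂ (inj₂ (inj₂ refl)))   = inj₁ (σ∙σ[a+H*a]≡e a)

  σ[a+H*a]∙-Cycσ : ∀ a {y} → Cycσ a y → Cycσ a (σ (a + H * a) ∙ y)
  σ[a+H*a]∙-Cycσ a (inj₁ refl)               = inj₂ (inj₂ (inj₂ (∙-identityʳ _)))
  σ[a+H*a]∙-Cycσ a (inj₂ (inj₁ refl))        = inj₁ (σ[a+H*a]∙σ≡e a)
  σ[a+H*a]∙-Cycσ a (inj₂ (inj₂ (inj₁ refl))) = inj₂ (inj₁ (σ[a+H*a]∙ρ[H*a]≡σ a))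
  σ[a+H*a]∙-Cycσ a (inj₂ (inj₂ (inj₂ refl))) = inj₂ (inj₂ (inj₁ (σ[a+H*a]∙σ[a+H*a]≡ρ[H*a] a)))

  Cyc-σ⇒Cycσ : ∀ a {y} → Cyc (σ a) y → Cycσ a y
  Cyc-σ⇒Cycσ a = Cyc-closed (Cycσ a) (inj₁ refl) (σ∙-Cycσ a)
    (λ {y} y∈ → subst (λ x → Cycσ a (x ∙ y)) (sym (inv-σ≡σ[a+H*a] a)) (σ[a+H*a]∙-Cycσ a y∈))

  Cycσ-rotation : ∀ {a x} → Cycσ a x → Rotation x → x ≡ e ⊎ x ≡ ρ (H * a)
  Cycσ-rotation (inj₁ x≡e)                _ = inj₁ x≡e
  Cycσ-rotation (inj₂ (inj₁ refl))          ()
  Cycσ-rotation (inj₂ (inj₂ (inj₁ x≡ρ)))    _ = inj₂ x≡ρ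
  Cycσ-rotation (inj₂ (inj₂ (inj₂ refl)))   ()

  Cycσ-reflection : ∀ {a y} → Cycσ a y → ¬ Rotation y → y ≡ σ a ⊎ y ≡ σ (a + H * a)
  Cycσ-reflection (inj₁ refl)               ¬rot = ⊥-elim (¬rot refl)
  Cycσ-reflection (inj₂ (inj₁ y≡σ))         _    = inj₁ y≡σ
  Cycσ-reflection (inj₂ (inj₂ (inj₁ refl))) ¬rot = ⊥-elim (¬rot refl)
  Cycσ-reflection (inj₂ (inj₂ (inj₂ y≡σ)))  _    = inj₂ y≡σ

  σ^ⁿ2≡ρ[H*a] : ∀ a → σ a ^ⁿ 2 ≡ ρ (H * a)
  σ^ⁿ2≡ρ[H*a] a = trans (cong (σ a ∙_) (∙-identityʳ (σ a))) (σ∙σ≡ρ[H*a] a)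

  σ^ⁿ4≡e : ∀ a → σ a ^ⁿ 4 ≡ e
  σ^ⁿ4≡e a = begin
    σ a ∙ (σ a ∙ (σ a ^ⁿ 2)) ≡⟨ cong (λ x → σ a ∙ (σ a ∙ x)) (σ^ⁿ2≡ρ[H*a] a) ⟩
    σ a ∙ (σ a ∙ ρ (H * a))  ≡⟨ cong (σ a ∙_) (σ∙ρ a (H * a)) ⟩
    σ a ∙ σ (a + H * a)      ≡⟨ σ∙σ[a+H*a]≡e a ⟩
    e                        ∎
    where open ≡-Reasoning

  u : G
  u = r ^ⁿ H

  u≡ρH : u ≡ ρ H
  u≡ρH = r^ⁿ≡ρ H

  u-rotation : Rotation u
  u-rotation = cong proj₁ u≡ρH

  u∙u≡e : u ∙ u ≡ e
  u∙u≡e = trans (cong₂ _∙_ u≡ρH u≡ρH) (trans (ρ∙ρ H H) (ρ-cong H+H≋0))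

  inv-u≡u : inv u ≡ u
  inv-u≡u = trans (cong inv u≡ρH) (trans (inv-ρ H+H≋0) (sym u≡ρH))

  u≢e : u ≢ e
  u≢e u≡e = <⇒≢ 0<H (sym (begin
    H         ≡⟨ m<n⇒m%n≡m H<N ⟨
    H % N     ≡⟨ ρ-injective (trans (sym u≡ρH) u≡e) ⟩
    0 % N     ≡⟨ m*n%n≡0 0 N ⟩
    0         ∎))
    where open ≡-Reasoning

  Cyc-u : ∀ {x} → Cyc u x ⇔ (x ≡ e ⊎ x ≡ u)
  Cyc-u = mk⇔ (Cyc-closed P (inj₁ refl) u∙-P (λ {y} → subst (λ x → P (x ∙ y)) (sym inv-u≡u) ∘ u∙-P))
              [ (λ x≡e → + 0 , x≡e) , (λ x≡u → + 1 , trans x≡u (sym (∙-identityʳ u))) ]′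
    where
    P : G → Set
    P x = x ≡ e ⊎ x ≡ u
    u∙-P : ∀ {y} → P y → P (u ∙ y)
    u∙-P (inj₁ refl) = inj₂ (∙-identityʳ u)
    u∙-P (inj₂ refl) = inj₁ u∙u≡e

  ρ[H*2c]≡e : ∀ c → ρ (H * (2 * c)) ≡ e
  ρ[H*2c]≡e c = ρ-cong (trans (cong (_% N) (H*[2c]≡c*N c)) (*-≋0 c))

  ρ[H*[2c+1]]≡u : ∀ c → ρ (H * (2 * c + 1)) ≡ u
  ρ[H*[2c+1]]≡u c = trans (ρ-cong (trans (cong (_% N) (H*[2c+1]≡H+c*N c)) (+-*-≋ H c))) (sym u≡ρH)

  σ[2c+H*2c]≡σ[2c] : ∀ c → σ (2 * c + H * (2 * c)) ≡ σ (2 * c)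
  σ[2c+H*2c]≡σ[2c] c = σ-cong (trans (cong (λ n → (2 * c + n) % N) (H*[2c]≡c*N c)) (+-*-≋ (2 * c) c))

  g : ℕ → G
  g j = s ∙ (r ^ⁿ (2 * j + 1))

  g≡σ : ∀ j → g j ≡ σ (2 * j + 1)
  g≡σ j = s∙r^ⁿ≡σ (2 * j + 1)

  g^ⁿ2≡u : ∀ j → g j ^ⁿ 2 ≡ u
  g^ⁿ2≡u j = trans (cong (_^ⁿ 2) (g≡σ j)) (trans (σ^ⁿ2≡ρ[H*a] _) (ρ[H*[2c+1]]≡u j))

  g-order-4 : ∀ j → (g j ^ⁿ 4 ≡ e) × (g j ^ⁿ 2 ≢ e)
  g-order-4 j = trans (cong (_^ⁿ 4) (g≡σ j)) (σ^ⁿ4≡e _) , λ g²≡e → u≢e (trans (sym (g^ⁿ2≡u j)) g²≡e)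

  ⟨u⟩⊆⟨g⟩ : ∀ j {x} → Cyc u x → Cyc (g j) x
  ⟨u⟩⊆⟨g⟩ j x∈⟨u⟩ = [ (λ x≡e → + 0 , x≡e) , (λ x≡u → + 2 , trans x≡u (sym (g^ⁿ2≡u j))) ]′
                      (Equivalence.to Cyc-u x∈⟨u⟩)

  InvolutionEdge : G → G → Set
  InvolutionEdge x y = ∃[ t ] (1 ≤ t × t ≤ H
    × ((x ≡ e × y ≡ s ∙ (r ^ⁿ (2 * t))) ⊎ (x ≡ s ∙ (r ^ⁿ (2 * t)) × y ≡ e)))

  Order4Join : ℕ → G → G → Set
  Order4Join j = Join (Cyc u) (PAdjCyc u) (Generates (g j)) (Complete (Generates (g j)))

  Decomposition : G → G → Set
  Decomposition x y = PAdjCyc r x y ⊎ InvolutionEdge x y ⊎ ∃[ j ] (j < H × Order4Join j x y)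

  -- t ranges over 1 … H rather than 0 … H - 1: the involution s = s r^0 is s r^(2H).
  even-reflection : ∀ c → 2 * c < N → ∃[ t ] (1 ≤ t × t ≤ H × σ (2 * c) ≡ s ∙ (r ^ⁿ (2 * t)))
  even-reflection zero      _     = H , 0<H , ≤-refl ,
    sym (trans (s∙r^ⁿ≡σ (2 * H)) (σ-cong (trans (cong (_% N) (sym N≡2H)) N≋0)))
  even-reflection c@(suc _) 2c<N = c , s≤s z≤n , <⇒≤ (half-< 2c<N) , sym (s∙r^ⁿ≡σ (2 * c))

  rotation-power-of-reflection : ∀ {x y} b → b < N → y ≡ σ b → Rotation x → Cyc y x →
      (x ≡ e × ∃[ t ] (1 ≤ t × t ≤ H × y ≡ s ∙ (r ^ⁿ (2 * t))))
    ⊎ ∃[ j ] (j < H × Cyc u x × Generates (g j) y)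
  rotation-power-of-reflection b b<N refl rot x∈⟨y⟩
    with even-or-odd b | Cycσ-rotation (Cyc-σ⇒Cycσ b x∈⟨y⟩) rot
  ... | inj₁ (c , refl) | x≡e⊎x≡ρ =
    inj₁ ([ id , (λ x≡ρ → trans x≡ρ (ρ[H*2c]≡e c)) ]′ x≡e⊎x≡ρ , even-reflection c b<N)
  ... | inj₂ (c , refl) | x≡e⊎x≡ρ =
    inj₂ (c , half-odd-< b<N ,
          Equivalence.from Cyc-u (map₂ (λ x≡ρ → trans x≡ρ (ρ[H*[2c+1]]≡u c)) x≡e⊎x≡ρ) ,
          ≡⇒Generates (g≡σ c))

  reflection-power-of-reflection : ∀ {x y} a → a < N → x ≡ σ a → x ≢ y → ¬ Rotation y → Cyc x y →
    ∃[ j ] (j < H × Generates (g j) x × Generates (g j) y)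
  reflection-power-of-reflection a a<N refl x≢y ¬rot y∈⟨x⟩
    with even-or-odd a | Cycσ-reflection (Cyc-σ⇒Cycσ a y∈⟨x⟩) ¬rot
  ... | _               | inj₁ y≡x  = ⊥-elim (x≢y (sym y≡x))
  ... | inj₁ (c , refl) | inj₂ y≡σ′ = ⊥-elim (x≢y (sym (trans y≡σ′ (σ[2c+H*2c]≡σ[2c] c))))
  ... | inj₂ (c , refl) | inj₂ y≡σ′ =
    c , half-odd-< a<N , ≡⇒Generates (g≡σ c) ,
    subst₂ Generates (sym (g≡σ c)) (trans (inv-σ≡σ[a+H*a] _) (sym y≡σ′)) (Generates-inv (inv-σ-involutive _))

  adjacent⇒decomposition : ∀ x y → PAdj x y → Decomposition x y
  adjacent⇒decomposition (0F , i) (0F , j) adj = inj₁ (rotation∈⟨r⟩ refl , rotation∈⟨r⟩ refl , adj)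
  adjacent⇒decomposition (0F , i) (1F , j) (_ , inj₁ y∈⟨x⟩) = case Cyc-rotation refl y∈⟨x⟩ of λ ()
  adjacent⇒decomposition (0F , i) (1F , j) (_ , inj₂ x∈⟨y⟩)
    with rotation-power-of-reflection (toℕ j) (toℕ<n j) (σ-toℕ j) refl x∈⟨y⟩
  ... | inj₁ (x≡e , t , 1≤t , t≤H , y≡) = inj₂ (inj₁ (t , 1≤t , t≤H , inj₁ (x≡e , y≡)))
  ... | inj₂ (c , c<H , x∈⟨u⟩ , gen-y) = inj₂ (inj₂ (c , c<H , inj₂ (inj₂ (inj₁ (x∈⟨u⟩ , gen-y)))))
  adjacent⇒decomposition (1F , i) (0F , j) (_ , inj₂ x∈⟨y⟩) = case Cyc-rotation refl x∈⟨y⟩ of λ ()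
  adjacent⇒decomposition (1F , i) (0F , j) (_ , inj₁ y∈⟨x⟩)
    with rotation-power-of-reflection (toℕ i) (toℕ<n i) (σ-toℕ i) refl y∈⟨x⟩
  ... | inj₁ (y≡e , t , 1≤t , t≤H , x≡) = inj₂ (inj₁ (t , 1≤t , t≤H , inj₂ (x≡ , y≡e)))
  ... | inj₂ (c , c<H , y∈⟨u⟩ , gen-x) = inj₂ (inj₂ (c , c<H , inj₂ (inj₂ (inj₂ (gen-x , y∈⟨u⟩)))))
  adjacent⇒decomposition (1F , i) (1F , j) (x≢y , inj₁ y∈⟨x⟩)
    with reflection-power-of-reflection (toℕ i) (toℕ<n i) (σ-toℕ i) x≢y (λ ()) y∈⟨x⟩
  ... | c , c<H , gen-x , gen-y = inj₂ (inj₂ (c , c<H , inj₂ (inj₁ (gen-x , gen-y , x≢y))))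
  adjacent⇒decomposition (1F , i) (1F , j) (x≢y , inj₂ x∈⟨y⟩)
    with reflection-power-of-reflection (toℕ j) (toℕ<n j) (σ-toℕ j) (x≢y ∘ sym) (λ ()) x∈⟨y⟩
  ... | c , c<H , gen-y , gen-x = inj₂ (inj₂ (c , c<H , inj₂ (inj₁ (gen-x , gen-y , x≢y))))

  e≢s∙r^ⁿ : ∀ n → e ≢ s ∙ (r ^ⁿ n)
  e≢s∙r^ⁿ n e≡ = s∙r^ⁿ-not-rotation n (subst Rotation e≡ refl)

  spoke-adjacent : ∀ j {x y} → Cyc u x → Generates (g j) y → PAdj x y
  spoke-adjacent j {x} x∈⟨u⟩ gen-y = x≢y , inj₂ (Equivalence.to (gen-y x) (⟨u⟩⊆⟨g⟩ j x∈⟨u⟩))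
    where
    x≢y : x ≢ _
    x≢y refl = s∙r^ⁿ-not-rotation (2 * j + 1)
      (Cyc-rotation (Cyc-rotation u-rotation x∈⟨u⟩) (Equivalence.to (gen-y (g j)) Cyc-refl))

  decomposition⇒adjacent : ∀ {x y} → Decomposition x y → PAdj x y
  decomposition⇒adjacent (inj₁ (_ , _ , adj)) = adj
  decomposition⇒adjacent (inj₂ (inj₁ (t , _ , _ , inj₁ (refl , refl)))) = identity-adjacent (e≢s∙r^ⁿ (2 * t))
  decomposition⇒adjacent (inj₂ (inj₁ (t , _ , _ , inj₂ (refl , refl)))) =
    PAdj-sym (identity-adjacent (e≢s∙r^ⁿ (2 * t)))
  decomposition⇒adjacent (inj₂ (inj₂ (j , _ , join))) with join
  ... | inj₁ (_ , _ , adj)                      = adj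
  ... | inj₂ (inj₁ (gen-x , gen-y , x≢y))       = generators-adjacent gen-x gen-y x≢y
  ... | inj₂ (inj₂ (inj₁ (x∈⟨u⟩ , gen-y)))      = spoke-adjacent j x∈⟨u⟩ gen-y
  ... | inj₂ (inj₂ (inj₂ (gen-x , y∈⟨u⟩)))      = PAdj-sym (spoke-adjacent j y∈⟨u⟩ gen-x)

  power-graph-decomposition : ∀ x y → PAdj x y ⇔ Decomposition x y
  power-graph-decomposition x y = mk⇔ (adjacent⇒decomposition x y) decomposition⇒adjacent

-- Only the evenness of half[ k , p ] (from k ≥ 2) matters: primality of p is used just for p ≠ 0,
-- and its oddness not at all.
mainTheorem1 : (k p : ℕ) → 2 ≤ k → (pp : Prime p) → ¬ (2 ∣ p) →
  let open 𝒢 k p pp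
      u = r ^ⁿ half[ k , p ]
  in ((j : ℕ) → j < half[ k , p ] →
        ((s ∙ (r ^ⁿ (2 * j + 1))) ^ⁿ 4 ≡ e) × ((s ∙ (r ^ⁿ (2 * j + 1))) ^ⁿ 2 ≢ e))
     × ((x y : G) →
        PAdj x y ⇔
          (PAdjCyc r x y
           ⊎ (∃[ t ] (1 ≤ t × t ≤ half[ k , p ]
                × ((x ≡ e × y ≡ s ∙ (r ^ⁿ (2 * t))) ⊎ (x ≡ s ∙ (r ^ⁿ (2 * t)) × y ≡ e))))
           ⊎ (∃[ j ] (j < half[ k , p ]
                × Join (Cyc u) (PAdjCyc u)
                       (Generates (s ∙ (r ^ⁿ (2 * j + 1))))
                       (Complete (Generates (s ∙ (r ^ⁿ (2 * j + 1)))))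
                       x y))))
mainTheorem1 (suc (suc k)) p (s≤s (s≤s z≤n)) pp _ = (λ j _ → g-order-4 j) , power-graph-decomposition
  where
  half-even : 2 ^ suc k * p ≡ 2 ^ k * p * 2
  half-even = regroup (2 ^ k) p
    where
    regroup : ∀ x p → 2 * x * p ≡ x * p * 2
    regroup = solve-∀
  open Semidihedral N[ suc (suc k) , p ] half[ suc (suc k) , p ] {{nonZeroN (suc (suc k)) p pp}}
    (*-assoc 2 (2 ^ suc k) p) (divides (2 ^ k * p) half-even)
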